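{- Let $p>3$ be a prime. Define the rational number \[\delta(p) = (3p+1)!!! + \sum_{r=1}^{p-1}\frac{(3p+1)!!!}{3r+4}.\] Then $\delta(p)$ has denominator prime to $p$ and $\delta(p) \equiv -1 \pmod p$, i.e. $\delta(p) = -1$ in $\mathbb{F}_p$.
   Context: The triple factorial $n!!!$ for integers $n \geq 0$ is defined by $0!!! = 1!!! = 2!!! = 1$ and $n!!! = n \cdot (n-3)!!!$ for $n \geq 3$. -}

module Defs where

open import Data.Nat using (ℕ; zero; suc; _+_; _*_; _∸_)
open import Data.Integer using (+_)
open import Data.Rational using (ℚ; _/_) renaming (_+_ to _+ℚ_)
open import Data.List using (List; map; foldr; upTo)

_!!! : ℕ → ℕ
zero !!! = 1
suc zero !!! = 1
suc (suc zero) !!! = 1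
suc (suc (suc n)) !!! = suc (suc (suc n)) * (n !!!)

term : ℕ → ℕ → ℚ
term p r = (+ ((3 * p + 1) !!!)) / (suc (suc (suc (suc (3 * r)))))

δ : ℕ → ℚ
δ p = ((+ ((3 * p + 1) !!!)) / 1)
      +ℚ foldr _+ℚ_ (0ℤ/1) (map (term p) (map suc (upTo (p ∸ 1))))
  where
  0ℤ/1 : ℚ
  0ℤ/1 = (+ 0) / 1

module Submission where

-- Write N = (3p+1)!!! = ∏_{i ≤ p} (3i+1). Each denominator 3r+4 = 3(r+1)+1 (1 ≤ r ≤ p-1) is one
-- of these factors, so δ(p) is the natural number N + Σ_{j=2}^{p} N/(3j+1). Since p ∤ 3, the
-- numbers 3i+1 (i < p) form a complete residue system mod p; let k be the index with p ∣ 3k+1.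
-- As 3·0+1 = 1 and 3·1+1 = 4 are units, 2 ≤ k < p. Hence p divides N and every N/(3j+1) with
-- j ≠ k, while N/(3k+1) = (3p+1)·∏_{i<p, i≠k} (3i+1) ≡ 1·(-1) by Wilson's theorem for the
-- reduced residue system {3i+1 : i < p, i ≠ k}. Wilson's theorem is proved by pairing each
-- element with its inverse: only ±1 are their own inverses.

open import Level using (Level; 0ℓ)
open import Algebra.Bundles using (CommutativeMonoid)
open import Data.Empty using (⊥-elim)
open import Data.List using (List; []; _∷_; map; foldr; length; upTo; applyDownFrom)
open import Data.List.Relation.Unary.Any using (here; there)
open import Data.Nat.Base using (ℕ; zero; suc; _≤_; _<_; s≤s; NonZero)
import Data.Nat.Properties as ℕ
open import Data.Nat.Primality using (Prime)
open import Data.Product using (∃-syntax; _×_; _,_)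
import Data.Product as Product
open import Data.Sum using (_⊎_; inj₁; inj₂; [_,_]′)
import Data.Sum as Sum
open import Function using (_∘_)
open import Relation.Binary.Bundles using (Setoid)
open import Relation.Binary.Structures using (IsEquivalence)
open import Relation.Binary.PropositionalEquality.Core using (_≡_; _≢_)
import Relation.Binary.PropositionalEquality as ≡
open import Relation.Nullary using (¬_)
import Data.List.Membership.Setoid as Membership
import Data.List.Membership.Setoid.Properties as Membershipₚ
import Data.List.Relation.Binary.Permutation.Setoid as Permutation
import Data.List.Relation.Binary.Permutation.Setoid.Properties as Permutationₚ
import Data.List.Relation.Unary.Unique.Setoid as UniqueS
import Data.List.Relation.Unary.Unique.Setoid.Properties as Uniqueₚ
import Relation.Binary.Reasoning.Setoid as SetoidReasoning

private variable a ℓ : Level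

module _ (S : Setoid a ℓ) where
  open Setoid S
  open Membership S using (_∈_)
  open Permutation S using (_↭_; ↭-refl; ↭-prep; ↭-swap; ↭-trans)
  open UniqueS S using (Unique)

  ∈⇒↭∷ : ∀ {x xs} → x ∈ xs → ∃[ ys ] xs ↭ x ∷ ys
  ∈⇒↭∷ (here {xs = ys} x≈y) = ys , Permutation.prep (sym x≈y) ↭-refl
  ∈⇒↭∷ (there {x = y} x∈xs) with ys , xs↭x∷ys ← ∈⇒↭∷ x∈xs =
    y ∷ ys , ↭-trans (↭-prep y xs↭x∷ys) (↭-swap y _ ↭-refl)

  ∈-tail : ∀ {x z xs} → z ∈ x ∷ xs → ¬ z ≈ x → z ∈ xs
  ∈-tail (here z≈x)   z≉x = ⊥-elim (z≉x z≈x)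
  ∈-tail (there z∈xs) _   = z∈xs

  Unique[x∷xs]∧z∈xs⇒z≉x : ∀ {x z xs} → Unique (x ∷ xs) → z ∈ xs → ¬ z ≈ x
  Unique[x∷xs]∧z∈xs⇒z≉x uniq z∈xs z≈x =
    Uniqueₚ.Unique[x∷xs]⇒x∉xs S uniq (Membershipₚ.∈-resp-≈ S z≈x z∈xs)

module InversePairing (M : CommutativeMonoid a ℓ) where
  open CommutativeMonoid M renaming (Carrier to A)
  open Membership setoid using (_∈_)
  open Permutation setoid using (_↭_; ↭-sym; ↭-prep)
  open Permutationₚ setoid using (∈-resp-↭; Unique-resp-↭; xs↭ys⇒|xs|≡|ys|; foldr-commMonoid)
  open UniqueS setoid using (Unique; tail)
  open SetoidReasoning setoid

  ∏ : List A → A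
  ∏ = foldr _∙_ ε

  InverseClosed : List A → Set _
  InverseClosed xs = ∀ {x} → x ∈ xs → ∃[ y ] (y ∈ xs × x ∙ y ≈ ε)

  inverse-unique : ∀ {x y z} → x ∙ y ≈ ε → x ∙ z ≈ ε → y ≈ z
  inverse-unique {x} {y} {z} xy≈ε xz≈ε = begin
    y            ≈⟨ identityʳ y ⟨
    y ∙ ε        ≈⟨ ∙-congˡ xz≈ε ⟨
    y ∙ (x ∙ z)  ≈⟨ assoc y x z ⟨
    (y ∙ x) ∙ z  ≈⟨ ∙-congʳ (trans (comm y x) xy≈ε) ⟩
    ε ∙ z        ≈⟨ identityˡ z ⟩
    z            ∎

  InverseClosed-resp-↭ : ∀ {xs ys} → xs ↭ ys → InverseClosed xs → InverseClosed ys
  InverseClosed-resp-↭ xs↭ys inv x∈ys with y , y∈xs , xy≈ε ← inv (∈-resp-↭ (↭-sym xs↭ys) x∈ys) =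
    y , ∈-resp-↭ xs↭ys y∈xs , xy≈ε

  InverseClosed-dropPair : ∀ {x y zs} → Unique (x ∷ y ∷ zs) → x ∙ y ≈ ε →
                           InverseClosed (x ∷ y ∷ zs) → InverseClosed zs
  InverseClosed-dropPair {x} {y} uniq xy≈ε inv {z} z∈zs with inv (there (there z∈zs))
  ... | w , here w≈x , zw≈ε = ⊥-elim (Unique[x∷xs]∧z∈xs⇒z≉x setoid (tail uniq) z∈zs z≈y)
    where
    z≈y : z ≈ y
    z≈y = inverse-unique (trans (comm x z) (trans (∙-congˡ (sym w≈x)) zw≈ε)) xy≈ε
  ... | w , there (here w≈y) , zw≈ε = ⊥-elim (Unique[x∷xs]∧z∈xs⇒z≉x setoid uniq (there z∈zs) z≈x)
    where
    z≈x : z ≈ x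
    z≈x = inverse-unique (trans (comm y z) (trans (∙-congˡ (sym w≈y)) zw≈ε)) (trans (comm y x) xy≈ε)
  ... | w , there (there w∈zs) , zw≈ε = w , w∈zs , zw≈ε

  ∏-inverseClosed≈ε : ∀ {xs} → Unique xs → InverseClosed xs →
                      (∀ {x} → x ∈ xs → ¬ x ∙ x ≈ ε) → ∏ xs ≈ ε
  ∏-inverseClosed≈ε {xs} = go (length xs) ℕ.≤-refl
    where
    -- recursion on a bound for the length, as each step removes a pair x, x⁻¹
    go : ∀ n {xs} → length xs ≤ n → Unique xs → InverseClosed xs →
         (∀ {x} → x ∈ xs → ¬ x ∙ x ≈ ε) → ∏ xs ≈ ε
    go _ {[]} _ _ _ _ = refl
    go (suc n) {x ∷ rest} (s≤s |rest|≤n) uniq inv noSquare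
      with y , y∈x∷rest , xy≈ε ← inv (here refl)
      with zs , rest↭y∷zs ← ∈⇒↭∷ setoid (∈-tail setoid y∈x∷rest (λ y≈x → noSquare (here refl) (trans (∙-congˡ (sym y≈x)) xy≈ε)))
      = begin
        x ∙ ∏ rest      ≈⟨ ∙-congˡ (foldr-commMonoid isCommutativeMonoid rest↭y∷zs) ⟩
        x ∙ (y ∙ ∏ zs)  ≈⟨ assoc x y (∏ zs) ⟨
        (x ∙ y) ∙ ∏ zs  ≈⟨ ∙-cong xy≈ε (go n |zs|≤n (tail (tail uniq′)) (InverseClosed-dropPair uniq′ xy≈ε inv′) noSquare′) ⟩
        ε ∙ ε           ≈⟨ identityˡ ε ⟩
        ε               ∎
      where
      xs↭ : x ∷ rest ↭ x ∷ y ∷ zs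
      xs↭ = ↭-prep x rest↭y∷zs
      uniq′ : Unique (x ∷ y ∷ zs)
      uniq′ = Unique-resp-↭ xs↭ uniq
      inv′ : InverseClosed (x ∷ y ∷ zs)
      inv′ = InverseClosed-resp-↭ xs↭ inv
      noSquare′ : ∀ {z} → z ∈ zs → ¬ z ∙ z ≈ ε
      noSquare′ z∈zs = noSquare (∈-resp-↭ (↭-sym xs↭) (there (there z∈zs)))
      |zs|≤n : length zs ≤ n
      |zs|≤n = ℕ.<⇒≤ (≡.subst (_≤ n) (xs↭ys⇒|xs|≡|ys| rest↭y∷zs) |rest|≤n)

module Congruence (p : ℕ) where
  open import Data.Integer.Base using (ℤ; +_; _+_; _-_; _*_; -_; 0ℤ; 1ℤ)
  import Data.Integer.Properties as ℤ
  open import Data.Integer.Divisibility.Signed using (_∣_; divides; ∣m∣n⇒∣m+n; ∣m⇒∣-m; ∣n⇒∣m*n; ∣m⇒∣m*n)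
  open import Data.Integer.Tactic.RingSolver using (solve-∀)
  open import Relation.Binary.PropositionalEquality using (refl; sym; subst)

  -- a record rather than a synonym for + p ∣ a - b, so that a and b can be inferred from a ≈ b
  infix 4 _≈_
  record _≈_ (a b : ℤ) : Set where
    constructor mk≈
    field p∣a-b : + p ∣ a - b
  open _≈_ public

  ≈-by : ∀ {a b c} → a - b ≡ c → + p ∣ c → a ≈ b
  ≈-by eq = mk≈ ∘ subst (+ p ∣_) (sym eq)

  ∣⇒≈0 : ∀ {a} → + p ∣ a → a ≈ 0ℤ
  ∣⇒≈0 {a} = ≈-by (ℤ.+-identityʳ a)

  ≈0⇒∣ : ∀ {a} → a ≈ 0ℤ → + p ∣ a
  ≈0⇒∣ {a} = subst (+ p ∣_) (ℤ.+-identityʳ a) ∘ p∣a-b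

  ≈-refl : ∀ {a} → a ≈ a
  ≈-refl {a} = ≈-by (ℤ.+-inverseʳ a) (divides 0ℤ refl)

  ≈-reflexive : ∀ {a b} → a ≡ b → a ≈ b
  ≈-reflexive refl = ≈-refl

  ≈-sym : ∀ {a b} → a ≈ b → b ≈ a
  ≈-sym {a} {b} = ≈-by (lemma a b) ∘ ∣m⇒∣-m ∘ p∣a-b
    where
    lemma : ∀ a b → b - a ≡ - (a - b)
    lemma = solve-∀

  ≈-trans : ∀ {a b c} → a ≈ b → b ≈ c → a ≈ c
  ≈-trans {a} {b} {c} (mk≈ a≈b) (mk≈ b≈c) = ≈-by (lemma a b c) (∣m∣n⇒∣m+n a≈b b≈c)
    where
    lemma : ∀ a b c → a - c ≡ (a - b) + (b - c)
    lemma = solve-∀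

  +-cong : ∀ {a b c d} → a ≈ b → c ≈ d → a + c ≈ b + d
  +-cong {a} {b} {c} {d} (mk≈ a≈b) (mk≈ c≈d) = ≈-by (lemma a b c d) (∣m∣n⇒∣m+n a≈b c≈d)
    where
    lemma : ∀ a b c d → (a + c) - (b + d) ≡ (a - b) + (c - d)
    lemma = solve-∀

  *-cong : ∀ {a b c d} → a ≈ b → c ≈ d → a * c ≈ b * d
  *-cong {a} {b} {c} {d} (mk≈ a≈b) (mk≈ c≈d) = ≈-by (lemma a b c d) (∣m∣n⇒∣m+n (∣m⇒∣m*n c a≈b) (∣n⇒∣m*n b c≈d))
    where
    lemma : ∀ a b c d → (a * c) - (b * d) ≡ (a - b) * c + b * (c - d)
    lemma = solve-∀

  ≈-isEquivalence : IsEquivalence _≈_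
  ≈-isEquivalence = record { refl = ≈-refl ; sym = ≈-sym ; trans = ≈-trans }

  *-commutativeMonoid : CommutativeMonoid 0ℓ 0ℓ
  *-commutativeMonoid = record
    { Carrier = ℤ
    ; _≈_ = _≈_
    ; _∙_ = _*_
    ; ε = 1ℤ
    ; isCommutativeMonoid = record
      { isMonoid = record
        { isSemigroup = record
          { isMagma = record { isEquivalence = ≈-isEquivalence ; ∙-cong = *-cong }
          ; assoc = λ a b c → ≈-reflexive (ℤ.*-assoc a b c)
          }
        ; identity = (λ a → ≈-reflexive (ℤ.*-identityˡ a)) , (λ a → ≈-reflexive (ℤ.*-identityʳ a))
        }
      ; comm = λ a b → ≈-reflexive (ℤ.*-comm a b)
      }
    }

  ≈-setoid : Setoid 0ℓ 0ℓ
  ≈-setoid = CommutativeMonoid.setoid *-commutativeMonoid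

  open Membership ≈-setoid using (_∈_)
  open UniqueS ≈-setoid using (Unique)

  record IsCompleteResidueSystem (xs : List ℤ) : Set where
    field
      unique : Unique xs
      covers : ∀ a → a ∈ xs

  record IsReducedResidueSystem (xs : List ℤ) : Set where
    field
      unique  : Unique xs
      nonzero : ∀ {x} → x ∈ xs → ¬ x ≈ 0ℤ
      covers  : ∀ {a} → ¬ a ≈ 0ℤ → a ∈ xs

  open Permutation ≈-setoid using (_↭_)

  complete-resp-↭ : ∀ {xs ys} → xs ↭ ys → IsCompleteResidueSystem xs → IsCompleteResidueSystem ys
  complete-resp-↭ xs↭ys complete = record
    { unique = Permutationₚ.Unique-resp-↭ ≈-setoid xs↭ys unique
    ; covers = Permutationₚ.∈-resp-↭ ≈-setoid xs↭ys ∘ covers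
    }
    where open IsCompleteResidueSystem complete

  complete⇒reduced : ∀ {z xs} → IsCompleteResidueSystem (z ∷ xs) → z ≈ 0ℤ → IsReducedResidueSystem xs
  complete⇒reduced complete z≈0 = record
    { unique  = UniqueS.tail ≈-setoid unique
    ; nonzero = λ x∈xs x≈0 → Unique[x∷xs]∧z∈xs⇒z≉x ≈-setoid unique x∈xs (≈-trans x≈0 (≈-sym z≈0))
    ; covers  = λ {a} a≉0 → ∈-tail ≈-setoid (covers a) (λ a≈z → a≉0 (≈-trans a≈z z≈0))
    }
    where open IsCompleteResidueSystem complete

module PrimeModulus {p : ℕ} (prime : Prime p) where
  open import Data.Integer.Base as ℤ using (ℤ; +_; _+_; _-_; _*_; -_; 0ℤ; 1ℤ; -1ℤ; ∣_∣)
  import Data.Integer.Properties as ℤ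
  import Data.Integer.DivMod as ℤ
  open import Data.Integer.Divisibility.Signed using (_∣_; ∣-refl; ∣ᵤ⇒∣; ∣⇒∣ᵤ; ∣m⇒∣-m; ∣n⇒∣m*n)
  open import Data.Integer.Tactic.RingSolver using (solve-∀)
  import Data.Nat.Base as ℕ
  import Data.Nat.Divisibility as ℕ
  open import Data.Nat.Coprimality using (Coprime; coprime-Bézout)
  open import Data.Nat.GCD using (module Bézout)
  open import Data.Nat.Primality using (¬prime[1]; euclidsLemma; prime⇒irreducible; prime⇒nonZero)
  open import Relation.Binary.PropositionalEquality using (refl; sym; trans; cong; subst)

  open Congruence p public
  open Membership ≈-setoid using (_∈_)
  open UniqueS ≈-setoid using (Unique)

  private instance
    p≢0 : NonZero p
    p≢0 = prime⇒nonZero prime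

  open SetoidReasoning ≈-setoid
  open Permutation ≈-setoid using (_↭_; ↭-trans; ↭-prep; ↭-sym)
  open Permutationₚ ≈-setoid using (∈-resp-↭; Unique-resp-↭; foldr-commMonoid)

  a*b≈0⇒a≈0⊎b≈0 : ∀ {a b} → a * b ≈ 0ℤ → a ≈ 0ℤ ⊎ b ≈ 0ℤ
  a*b≈0⇒a≈0⊎b≈0 {a} {b} ab≈0 = Sum.map (∣⇒≈0 ∘ ∣ᵤ⇒∣) (∣⇒≈0 ∘ ∣ᵤ⇒∣)
    (euclidsLemma ∣ a ∣ ∣ b ∣ prime (subst (p ℕ.∣_) (ℤ.abs-* a b) (∣⇒∣ᵤ (≈0⇒∣ ab≈0))))

  ≈⇒-≈0 : ∀ {a b} → a ≈ b → a - b ≈ 0ℤ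
  ≈⇒-≈0 = ∣⇒≈0 ∘ p∣a-b

  -≈0⇒≈ : ∀ {a b} → a - b ≈ 0ℤ → a ≈ b
  -≈0⇒≈ = mk≈ ∘ ≈0⇒∣

  *-cancelˡ-≈ : ∀ {a b c} → ¬ a ≈ 0ℤ → a * b ≈ a * c → b ≈ c
  *-cancelˡ-≈ {a} {b} {c} a≉0 ab≈ac =
    [ ⊥-elim ∘ a≉0 , -≈0⇒≈ ]′ (a*b≈0⇒a≈0⊎b≈0 (≈-trans (≈-reflexive (lemma a b c)) (≈⇒-≈0 ab≈ac)))
    where
    lemma : ∀ a b c → a * (b - c) ≡ a * b - a * c
    lemma = solve-∀

  1≉0 : ¬ 1ℤ ≈ 0ℤ
  1≉0 1≈0 = ¬prime[1] (subst Prime (ℕ.∣1⇒≡1 (∣⇒∣ᵤ (≈0⇒∣ 1≈0))) prime)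

  ≈-%ℕ : ∀ a → a ≈ + (a ℤ.%ℕ p)
  ≈-%ℕ a = ≈-by (trans (cong (_- + r) (ℤ.a≡a%ℕn+[a/ℕn]*n a p)) (lemma (+ r) q (+ p))) (∣n⇒∣m*n q ∣-refl)
    where
    r : ℕ
    r = a ℤ.%ℕ p
    q : ℤ
    q = a ℤ./ℕ p
    lemma : ∀ r q p → (r + q * p) - r ≡ q * p
    lemma = solve-∀

  bounded-≈⇒≡ : ∀ {i j} → i < p → j < p → + i ≈ + j → i ≡ j
  bounded-≈⇒≡ {i} {j} i<p j<p (mk≈ p∣i-j) =
    ℤ.+-injective (ℤ.i-j≡0⇒i≡j (+ i) (+ j) (trans (ℤ.m-n≡m⊖n i j) (ℤ.∣i∣≡0⇒i≡0 (small (ℤ.∣m⊝n∣≤m⊔n i j) p∣∣i⊖j∣))))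
    where
    p∣∣i⊖j∣ : p ℕ.∣ ∣ i ℤ.⊖ j ∣
    p∣∣i⊖j∣ = subst (p ℕ.∣_) (cong ∣_∣ (ℤ.m-n≡m⊖n i j)) (∣⇒∣ᵤ p∣i-j)
    small : ∀ {n} → n ℕ.≤ i ℕ.⊔ j → p ℕ.∣ n → n ≡ 0
    small {zero}  _   _   = refl
    small {suc n} n≤ p∣n = ⊥-elim (ℕ.>⇒∤ (ℕ.≤-<-trans n≤ (ℕ.⊔-lub i<p j<p)) p∣n)

  ≉0⇒invertible : ∀ {a} → ¬ a ≈ 0ℤ → ∃[ b ] a * b ≈ 1ℤ
  ≉0⇒invertible {a} a≉0 = Product.map₂ (≈-trans (*-cong (≈-%ℕ a) ≈-refl)) (bézout⇒invertible (coprime-Bézout coprime))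
    where
    r : ℕ
    r = a ℤ.%ℕ p
    coprime : Coprime r p
    coprime {d} (d∣r , d∣p) = [ (λ d≡1 → d≡1) , (λ d≡p → ⊥-elim (a≉0 (a≈0 (subst (ℕ._∣ r) d≡p d∣r)))) ]′
      (prime⇒irreducible prime d∣p)
      where
      a≈0 : p ℕ.∣ r → a ≈ 0ℤ
      a≈0 p∣r = ≈-trans (≈-%ℕ a) (∣⇒≈0 (∣ᵤ⇒∣ p∣r))
    pos-1+* : ∀ m n → + (1 ℕ.+ m ℕ.* n) ≡ 1ℤ + + m * + n
    pos-1+* m n = trans (ℤ.pos-+ 1 (m ℕ.* n)) (cong (_+_ 1ℤ) (ℤ.pos-* m n))
    bézout⇒invertible : Bézout.Identity 1 r p → ∃[ b ] + r * b ≈ 1ℤ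
    bézout⇒invertible (Bézout.+- x y eq) = + x , (begin
      + r * + x               ≡⟨ trans (ℤ.*-comm (+ r) (+ x)) (sym (ℤ.pos-* x r)) ⟩
      + (x ℕ.* r)             ≡⟨ cong +_ eq ⟨
      + (1 ℕ.+ y ℕ.* p)       ≡⟨ pos-1+* y p ⟩
      1ℤ + + y * + p          ≈⟨ +-cong (≈-refl {1ℤ}) (∣⇒≈0 {+ y * + p} (∣n⇒∣m*n (+ y) ∣-refl)) ⟩
      1ℤ                      ∎)
    bézout⇒invertible (Bézout.-+ x y eq) = - + x , (begin
      + r * - + x             ≡⟨ lemma (+ r) (+ x) ⟩
      1ℤ - (1ℤ + + x * + r)   ≡⟨ cong (_-_ 1ℤ) (pos-1+* x r) ⟨
      1ℤ - + (1 ℕ.+ x ℕ.* r)  ≡⟨ cong (λ t → 1ℤ - + t) eq ⟩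
      1ℤ - + (y ℕ.* p)        ≈⟨ +-cong (≈-refl {1ℤ}) (∣⇒≈0 { - + (y ℕ.* p)} (∣m⇒∣-m (∣ᵤ⇒∣ {i = + (y ℕ.* p)} (ℕ.n∣m*n y)))) ⟩
      1ℤ                      ∎)
      where
      lemma : ∀ r x → r * - x ≡ 1ℤ - (1ℤ + x * r)
      lemma = solve-∀

  affine-injective : ∀ {a b i j} → ¬ a ≈ 0ℤ → i < p → j < p → a * + i + b ≈ a * + j + b → i ≡ j
  affine-injective {a} {b} {i} {j} a≉0 i<p j<p (mk≈ p∣) =
    bounded-≈⇒≡ i<p j<p (*-cancelˡ-≈ a≉0 (≈-by (lemma a b (+ i) (+ j)) p∣))
    where
    lemma : ∀ a b i j → a * i - a * j ≡ (a * i + b) - (a * j + b)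
    lemma = solve-∀

  affine-surjective : ∀ {a} b → ¬ a ≈ 0ℤ → ∀ y → ∃[ i ] (i < p × a * + i + b ≈ y)
  affine-surjective {a} b a≉0 y = i , ℤ.n%ℕd<d ((y - b) * c) p , fi≈y
    where
    c : ℤ
    c = Product.proj₁ (≉0⇒invertible a≉0)
    i : ℕ
    i = (y - b) * c ℤ.%ℕ p
    lemma : ∀ a b c y → a * ((y - b) * c) + b ≡ (a * c) * (y - b) + b
    lemma = solve-∀
    lemma₂ : ∀ b y → 1ℤ * (y - b) + b ≡ y
    lemma₂ = solve-∀
    fi≈y : a * + i + b ≈ y
    fi≈y = begin
      a * + i + b            ≈⟨ +-cong (*-cong (≈-refl {a}) (≈-sym (≈-%ℕ ((y - b) * c)))) (≈-refl {b}) ⟩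
      a * ((y - b) * c) + b  ≡⟨ lemma a b c y ⟩
      (a * c) * (y - b) + b  ≈⟨ +-cong (*-cong (Product.proj₂ (≉0⇒invertible a≉0)) (≈-refl {y - b})) (≈-refl {b}) ⟩
      1ℤ * (y - b) + b       ≡⟨ lemma₂ b y ⟩
      y                      ∎

  affine-complete : ∀ {a} b → ¬ a ≈ 0ℤ → IsCompleteResidueSystem (applyDownFrom (λ i → a * + i + b) p)
  affine-complete {a} b a≉0 = record
    { unique = Uniqueₚ.applyDownFrom⁺₁ ≈-setoid (λ i → a * + i + b) p
        (λ j<i i<p fi≈fj → ℕ.<-irrefl (sym (affine-injective a≉0 i<p (ℕ.<-trans j<i i<p) fi≈fj)) j<i)
    ; covers = λ y → let i , i<p , fi≈y = affine-surjective b a≉0 y in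
        Membershipₚ.∈-resp-≈ ≈-setoid fi≈y (Membershipₚ.∈-applyDownFrom⁺ ≈-setoid (λ i → a * + i + b) i<p)
    }

  -1≉0 : ¬ -1ℤ ≈ 0ℤ
  -1≉0 -1≈0 = 1≉0 (*-cong -1≈0 -1≈0)

  -1≉1 : 2 < p → ¬ -1ℤ ≈ 1ℤ
  -1≉1 2<p (mk≈ p∣-2) = ℕ.<⇒≱ 2<p (ℕ.∣⇒≤ (∣⇒∣ᵤ p∣-2))

  x*x≈1⇒x≈±1 : ∀ {x} → x * x ≈ 1ℤ → x ≈ 1ℤ ⊎ x ≈ -1ℤ
  x*x≈1⇒x≈±1 {x} xx≈1 =
    Sum.map -≈0⇒≈ (-≈0⇒≈ ∘ ≈-trans (≈-reflexive (lemma₂ x))) (a*b≈0⇒a≈0⊎b≈0 (≈-trans (≈-reflexive (lemma₁ x)) (≈⇒-≈0 xx≈1)))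
    where
    lemma₁ : ∀ x → (x - 1ℤ) * (x + 1ℤ) ≡ x * x - 1ℤ
    lemma₁ = solve-∀
    lemma₂ : ∀ x → x - -1ℤ ≡ x + 1ℤ
    lemma₂ = solve-∀

  open InversePairing *-commutativeMonoid using (∏; InverseClosed; inverse-unique; ∏-inverseClosed≈ε)

  reduced↭±1∷ : 2 < p → ∀ {xs} → IsReducedResidueSystem xs → ∃[ zs ] xs ↭ 1ℤ ∷ -1ℤ ∷ zs
  reduced↭±1∷ 2<p {xs} record { covers = covers }
    with ys , xs↭1∷ys ← ∈⇒↭∷ ≈-setoid (covers 1≉0)
    with zs , ys↭-1∷zs ← ∈⇒↭∷ ≈-setoid (∈-tail ≈-setoid (∈-resp-↭ xs↭1∷ys (covers -1≉0)) (-1≉1 2<p))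
    = zs , ↭-trans xs↭1∷ys (↭-prep 1ℤ ys↭-1∷zs)

  ∏-reduced∖±1≈1 : ∀ {xs zs} → IsReducedResidueSystem xs → xs ↭ 1ℤ ∷ -1ℤ ∷ zs → ∏ zs ≈ 1ℤ
  ∏-reduced∖±1≈1 {xs} {zs} reduced xs↭ = ∏-inverseClosed≈ε (UniqueS.tail ≈-setoid (UniqueS.tail ≈-setoid uniq)) inverseClosed
    (λ z∈zs zz≈1 → [ z≉1 z∈zs , z≉-1 z∈zs ]′ (x*x≈1⇒x≈±1 zz≈1))
    where
    open IsReducedResidueSystem reduced
    uniq : Unique (1ℤ ∷ -1ℤ ∷ zs)
    uniq = Unique-resp-↭ xs↭ unique
    z≉1 : ∀ {z} → z ∈ zs → ¬ z ≈ 1ℤ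
    z≉1 z∈zs = Unique[x∷xs]∧z∈xs⇒z≉x ≈-setoid uniq (there z∈zs)
    z≉-1 : ∀ {z} → z ∈ zs → ¬ z ≈ -1ℤ
    z≉-1 = Unique[x∷xs]∧z∈xs⇒z≉x ≈-setoid (UniqueS.tail ≈-setoid uniq)
    selfInverse⇒≈ : ∀ {z w u} → z * w ≈ 1ℤ → w ≈ u → u * u ≈ 1ℤ → z ≈ u
    selfInverse⇒≈ {z} {w} {u} zw≈1 w≈u uu≈1 =
      inverse-unique {u} {z} {u} (≈-trans (≈-reflexive (ℤ.*-comm u z)) (≈-trans (*-cong (≈-refl {z}) (≈-sym w≈u)) zw≈1)) uu≈1
    inverseClosed : InverseClosed zs
    inverseClosed {z} z∈zs = locate (∈-resp-↭ xs↭ (covers w≉0))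
      where
      z-invertible : ∃[ w ] z * w ≈ 1ℤ
      z-invertible = ≉0⇒invertible (nonzero (∈-resp-↭ (↭-sym xs↭) (there (there z∈zs))))
      w : ℤ
      w = Product.proj₁ z-invertible
      zw≈1 : z * w ≈ 1ℤ
      zw≈1 = Product.proj₂ z-invertible
      w≉0 : ¬ w ≈ 0ℤ
      w≉0 w≈0 = 1≉0 (≈-trans (≈-sym zw≈1) (≈-trans (*-cong (≈-refl {z}) w≈0) (≈-reflexive (ℤ.*-zeroʳ z))))
      locate : w ∈ 1ℤ ∷ -1ℤ ∷ zs → ∃[ y ] (y ∈ zs × z * y ≈ 1ℤ)
      locate (here w≈1)           = ⊥-elim (z≉1 z∈zs (selfInverse⇒≈ zw≈1 w≈1 ≈-refl))
      locate (there (here w≈-1))  = ⊥-elim (z≉-1 z∈zs (selfInverse⇒≈ zw≈1 w≈-1 ≈-refl))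
      locate (there (there w∈zs)) = w , w∈zs , zw≈1

  reduced⇒∏≈-1 : 2 < p → ∀ {xs} → IsReducedResidueSystem xs → ∏ xs ≈ -1ℤ
  reduced⇒∏≈-1 2<p {xs} reduced =
    let zs , xs↭ = reduced↭±1∷ 2<p reduced in begin
      ∏ xs               ≈⟨ foldr-commMonoid (CommutativeMonoid.isCommutativeMonoid *-commutativeMonoid) xs↭ ⟩
      1ℤ * (-1ℤ * ∏ zs)  ≈⟨ *-cong (≈-refl {1ℤ}) (*-cong (≈-refl { -1ℤ}) (∏-reduced∖±1≈1 reduced xs↭)) ⟩
      -1ℤ                ∎

module TripleFactorial where
  open import Defs using (_!!!)
  open import Data.Integer.Base using (+_; 1ℤ)
  import Data.Integer.Base as ℤ
  import Data.Integer.Properties as ℤ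
  open import Data.List.Membership.Propositional.Properties using (∈-applyDownFrom⁺)
  open import Data.Nat.Base using (_+_; _*_)
  open import Data.Nat.Divisibility using (_∣_)
  open import Data.Nat.ListAction using (product)
  open import Data.Nat.ListAction.Properties using (∈⇒∣product)
  open import Data.Nat.Tactic.RingSolver using (solve-∀)
  open import Relation.Binary.PropositionalEquality using (refl; trans; cong; cong₂; module ≡-Reasoning)

  progression : ℕ → ℕ
  progression i = suc (3 * i)

  progression-suc : ∀ r → progression (suc r) ≡ 4 + 3 * r
  progression-suc r = cong suc (ℕ.*-suc 3 r)

  !!!≡product : ∀ n → (3 * n + 1) !!! ≡ product (applyDownFrom progression (suc n))
  !!!≡product zero    = refl
  !!!≡product (suc n) = begin
    (3 * suc n + 1) !!!                  ≡⟨ cong (λ m → (m + 1) !!!) (ℕ.*-suc 3 n) ⟩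
    (3 + (3 * n + 1)) * (3 * n + 1) !!!  ≡⟨ cong₂ _*_ (lemma n) (!!!≡product n) ⟩
    progression (suc n) * product (applyDownFrom progression (suc n)) ∎
    where
    open ≡-Reasoning
    lemma : ∀ n → 3 + (3 * n + 1) ≡ 1 + 3 * (1 + n)
    lemma = solve-∀

  progression∣!!! : ∀ {j n} → j ≤ n → progression j ∣ (3 * n + 1) !!!
  progression∣!!! {j} {n} j≤n rewrite !!!≡product n = ∈⇒∣product (∈-applyDownFrom⁺ progression (s≤s j≤n))

  pos-progression : ∀ i → + progression i ≡ + 3 ℤ.* + i ℤ.+ 1ℤ
  pos-progression i = trans (cong (ℤ._+_ 1ℤ) (ℤ.pos-* 3 i)) (ℤ.+-comm 1ℤ (+ 3 ℤ.* + i))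

  map-pos-progression : ∀ n → map +_ (applyDownFrom progression n) ≡ applyDownFrom (λ i → + 3 ℤ.* + i ℤ.+ 1ℤ) n
  map-pos-progression zero    = refl
  map-pos-progression (suc n) = cong₂ _∷_ (pos-progression n) (map-pos-progression n)

module Integrality where
  open import Defs using (_!!!; term; δ)
  open import Data.Integer.Base using (+_)
  import Data.Integer.Base as ℤ
  import Data.Integer.Properties as ℤ
  open import Data.List.Membership.Propositional using (_∈_)
  open import Data.List.Membership.Propositional.Properties using (∈-map⁺; ∈-map⁻; ∈-upTo⁺; ∈-upTo⁻)
  open import Data.List.Relation.Unary.All as All using (All)
  import Data.List.Relation.Unary.All.Properties as Allₚ
  import Data.List.Properties as List
  open import Data.Nat.Base using (_+_; _*_; _∸_; _/_)
  open import Data.Nat.Coprimality using (1-coprimeTo)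
  import Data.Nat.Coprimality as Coprime
  open import Data.Nat.DivMod using (m*n/n≡m)
  open import Data.Nat.Divisibility using (_∣_; divides-refl)
  open import Data.Nat.ListAction using (sum)
  open import Data.Rational.Base using (ℚ; mkℚ)
  import Data.Rational.Base as ℚ
  import Data.Rational.Properties as ℚ
  import Data.Rational.Unnormalised.Base as ℚᵘ
  open import Relation.Binary.PropositionalEquality using (refl; sym; trans; cong; cong₂; subst; module ≡-Reasoning)
  open TripleFactorial

  m<n∸1⇒2+m≤n : ∀ {m n} → m < n ∸ 1 → 2 + m ≤ n
  m<n∸1⇒2+m≤n {n = suc n} m<n = s≤s m<n

  summationRange : ℕ → List ℕ
  summationRange n = map suc (upTo (n ∸ 1))

  2+m<n⇒m<n∸1 : ∀ {m n} → 2 + m < n → m < n ∸ 1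
  2+m<n⇒m<n∸1 {n = suc n} (s≤s 1+m<n) = ℕ.<⇒≤ 1+m<n

  ∈-summationRange⁺ : ∀ {i n} → 2 + i < n → suc i ∈ summationRange n
  ∈-summationRange⁺ {n = n} = ∈-map⁺ suc ∘ ∈-upTo⁺ ∘ 2+m<n⇒m<n∸1 {n = n}

  ∈-summationRange⁻ : ∀ {r n} → r ∈ summationRange n → r < n
  ∈-summationRange⁻ {n = n} r∈ with i , i∈ , refl ← ∈-map⁻ suc r∈ = m<n∸1⇒2+m≤n {n = n} (∈-upTo⁻ i∈)

  δℕ : ℕ → ℕ
  δℕ p = (3 * p + 1) !!! + sum (map (λ r → (3 * p + 1) !!! / (4 + 3 * r)) (summationRange p))

  -- built with mkℚ rather than as + n / 1, so that ↥ and ↧ of it compute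
  fromℕ : ℕ → ℚ
  fromℕ n = mkℚ (+ n) 0 (Coprime.sym (1-coprimeTo n))

  n/1≡fromℕ : ∀ n → + n ℚ./ 1 ≡ fromℕ n
  n/1≡fromℕ n = ℚ.fromℚᵘ-toℚᵘ (fromℕ n)

  fromℕ-+ : ∀ m n → fromℕ m ℚ.+ fromℕ n ≡ fromℕ (m + n)
  fromℕ-+ m n = trans (ℚ./-cong {p₂ = + (m + n)} eq refl) (n/1≡fromℕ (m + n))
    where
    eq : + m ℤ.* + 1 ℤ.+ + n ℤ.* + 1 ≡ + (m + n)
    eq = trans (cong₂ ℤ._+_ (ℤ.*-identityʳ (+ m)) (ℤ.*-identityʳ (+ n))) (sym (ℤ.pos-+ m n))

  fromℕ-/ : ∀ {n} d .{{_ : NonZero d}} → d ∣ n → + n ℚ./ d ≡ fromℕ (n / d)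
  fromℕ-/ (suc d) (divides-refl q) = begin
    + (q * suc d) ℚ./ suc d     ≡⟨ ℚ.fromℚᵘ-cong {ℚᵘ.mkℚᵘ (+ (q * suc d)) d} {ℚᵘ.mkℚᵘ (+ q) 0} (ℚᵘ.*≡* eq) ⟩
    + q ℚ./ 1                   ≡⟨ n/1≡fromℕ q ⟩
    fromℕ q                     ≡⟨ cong fromℕ (m*n/n≡m q (suc d)) ⟨
    fromℕ (q * suc d / suc d) ∎
    where
    open ≡-Reasoning
    eq : + (q * suc d) ℤ.* + 1 ≡ + q ℤ.* + suc d
    eq = trans (ℤ.*-identityʳ _) (ℤ.pos-* q (suc d))

  sum-fromℕ : ∀ ns → foldr ℚ._+_ (+ 0 ℚ./ 1) (map fromℕ ns) ≡ fromℕ (sum ns)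
  sum-fromℕ []       = n/1≡fromℕ 0
  sum-fromℕ (n ∷ ns) = trans (cong (fromℕ n ℚ.+_) (sum-fromℕ ns)) (fromℕ-+ n (sum ns))

  δ≡fromℕ-δℕ : ∀ p → δ p ≡ fromℕ (δℕ p)
  δ≡fromℕ-δℕ p = begin
    δ p                                                         ≡⟨ cong₂ (λ a xs → a ℚ.+ foldr ℚ._+_ (+ 0 ℚ./ 1) xs)
                                                                     (n/1≡fromℕ N) (trans (List.map-cong-local terms≡) (List.map-∘ rs)) ⟩
    fromℕ N ℚ.+ foldr ℚ._+_ (+ 0 ℚ./ 1) (map fromℕ (map t rs))   ≡⟨ cong (fromℕ N ℚ.+_) (sum-fromℕ (map t rs)) ⟩
    fromℕ N ℚ.+ fromℕ (sum (map t rs))                          ≡⟨ fromℕ-+ N (sum (map t rs)) ⟩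
    fromℕ (δℕ p)                                                ∎
    where
    open ≡-Reasoning
    N : ℕ
    N = (3 * p + 1) !!!
    rs : List ℕ
    rs = summationRange p
    t : ℕ → ℕ
    t r = N / (4 + 3 * r)
    terms≡ : All (λ r → term p r ≡ fromℕ (t r)) rs
    terms≡ = Allₚ.map⁺ (All.map (λ {i} i<p∸1 → fromℕ-/ (4 + 3 * suc i)
               (subst (_∣ N) (progression-suc (suc i)) (progression∣!!! {n = p} (m<n∸1⇒2+m≤n {n = p} i<p∸1))))
               (Allₚ.all-upTo (p ∸ 1)))

module DeltaModP where
  open import Defs using (_!!!)
  open import Data.Integer.Base using (+_; 0ℤ; 1ℤ; -1ℤ)
  import Data.Integer.Base as ℤ
  import Data.Integer.Properties as ℤ
  open import Data.Integer.Divisibility.Signed using (∣⇒∣ᵤ; ∣ᵤ⇒∣; ∣n⇒∣m*n; ∣-refl)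
  open import Data.Integer.Tactic.RingSolver using (solve-∀)
  open import Data.List.Membership.Propositional using (_∈_)
  open import Data.List.Membership.Propositional.Properties using (∈-applyDownFrom⁺)
  open import Data.List.Relation.Unary.Unique.Propositional using (Unique)
  import Data.List.Relation.Unary.Unique.Propositional.Properties as UniqueProp
  open import Data.Nat.Base using (_+_; _*_; _∸_; _/_)
  open import Data.Nat.DivMod using (m*n/n≡m; m/n*n≡m; /-congˡ; /-congʳ)
  open import Data.Nat.Divisibility using (_∣_; _∣0; ∣-trans; ∣m∣n⇒∣m+n; ∣⇒≤)
  open import Data.Nat.ListAction using (sum; product)
  open import Data.Nat.Primality using (euclidsLemma; prime⇒nonZero)
  open import Data.Nat.Tactic.RingSolver using () renaming (solve-∀ to solveℕ-∀)
  open import Relation.Binary.PropositionalEquality using (refl; sym; trans; cong; subst; module ≡-Reasoning)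
  open TripleFactorial
  open Integrality using (δℕ; summationRange; ∈-summationRange⁺; ∈-summationRange⁻)

  pos-product : ∀ ns → + product ns ≡ foldr ℤ._*_ 1ℤ (map +_ ns)
  pos-product []       = refl
  pos-product (n ∷ ns) = trans (ℤ.pos-* n (product ns)) (cong (ℤ._*_ (+ n)) (pos-product ns))

  ∣-sum : ∀ {d} (f : ℕ → ℕ) {xs} → (∀ {x} → x ∈ xs → d ∣ f x) → d ∣ sum (map f xs)
  ∣-sum f {[]}     _     = _ ∣0
  ∣-sum f {x ∷ xs} d∣f∈ = ∣m∣n⇒∣m+n (d∣f∈ (here refl)) (∣-sum f (d∣f∈ ∘ there))

  module _ {p : ℕ} (prime : Prime p) (3<p : 3 < p) where

    open PrimeModulus prime

    private instance
      p≢0 : NonZero p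
      p≢0 = prime⇒nonZero prime

    3≉0 : ¬ + 3 ≈ 0ℤ
    3≉0 3≈0 = ℕ.<⇒≱ 3<p (∣⇒≤ (∣⇒∣ᵤ (≈0⇒∣ 3≈0)))

    progression-complete : IsCompleteResidueSystem (map +_ (applyDownFrom progression p))
    progression-complete = subst IsCompleteResidueSystem (sym (map-pos-progression p)) (affine-complete 1ℤ 3≉0)

    progression[p]≈1 : + progression p ≈ 1ℤ
    progression[p]≈1 = ≈-by (trans (cong (ℤ._- 1ℤ) (pos-progression p)) (lemma (+ p))) (∣n⇒∣m*n (+ 3) ∣-refl)
      where
      lemma : ∀ p → + 3 ℤ.* p ℤ.+ 1ℤ ℤ.- 1ℤ ≡ + 3 ℤ.* p
      lemma = solve-∀

    ∃-progression≈0 : ∃[ k ] (k < p × + progression k ≈ 0ℤ)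
    ∃-progression≈0 =
      Product.map₂ (λ {k} → Product.map₂ (≈-trans (≈-reflexive (pos-progression k)))) (affine-surjective 1ℤ 3≉0 0ℤ)

    4≉0 : ¬ + 4 ≈ 0ℤ
    4≉0 4≈0 = [ p∤2 , p∤2 ]′ (euclidsLemma 2 2 prime (∣⇒∣ᵤ (≈0⇒∣ 4≈0)))
      where
      p∤2 : ¬ p ∣ 2
      p∤2 p∣2 = ℕ.<⇒≱ 3<p (ℕ.≤-trans (∣⇒≤ p∣2) (ℕ.n≤1+n 2))

    zero-index-in-range : ∀ {k} → k < p → + progression k ≈ 0ℤ → ∃[ r ] (k ≡ suc r × r ∈ summationRange p)
    zero-index-in-range {zero}          _     1≈0 = ⊥-elim (1≉0 1≈0)
    zero-index-in-range {suc zero}      _     4≈0 = ⊥-elim (4≉0 4≈0)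
    zero-index-in-range {suc (suc i)} 2+i<p _   = suc i , refl , ∈-summationRange⁺ {n = p} 2+i<p

    module _ {k} (k<p : k < p) (progression[k]≈0 : + progression k ≈ 0ℤ) where

      N : ℕ
      N = (3 * p + 1) !!!

      progression≉0 : ∀ {j} → j ≤ p → j ≢ k → ¬ + progression j ≈ 0ℤ
      progression≉0 {j} j≤p j≢k j≈0 with ℕ.m≤n⇒m<n∨m≡n j≤p
      ... | inj₁ j<p = j≢k (affine-injective 3≉0 j<p k<p affine≈)
        where
        affine≈ : + 3 ℤ.* + j ℤ.+ 1ℤ ≈ + 3 ℤ.* + k ℤ.+ 1ℤ
        affine≈ = ≈-trans (≈-reflexive (sym (pos-progression j)))
                    (≈-trans j≈0 (≈-trans (≈-sym progression[k]≈0) (≈-reflexive (pos-progression k))))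
      ... | inj₂ refl = 1≉0 (≈-trans (≈-sym progression[p]≈1) j≈0)

      p∣N : p ∣ N
      p∣N = ∣-trans (∣⇒∣ᵤ (≈0⇒∣ progression[k]≈0)) (progression∣!!! (ℕ.<⇒≤ k<p))

      p∣N/progression : ∀ {j} → j ≤ p → j ≢ k → p ∣ N / progression j
      p∣N/progression {j} j≤p j≢k =
        [ (λ p∣q → p∣q) , (λ p∣f → ⊥-elim (progression≉0 j≤p j≢k (∣⇒≈0 (∣ᵤ⇒∣ p∣f)))) ]′
          (euclidsLemma (N / progression j) (progression j) prime
            (subst (p ∣_) (sym (m/n*n≡m (progression∣!!! j≤p))) p∣N))

      p∣N/progression[k]+1 : p ∣ N / progression k + 1
      p∣N/progression[k]+1 = ∣⇒∣ᵤ (p∣a-b quotient≈-1)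
        where
        open Permutation (≡.setoid ℕ) using () renaming (_↭_ to _↭ₙ_)
        extracted : ∃[ R ] applyDownFrom progression p ↭ₙ progression k ∷ R
        extracted = ∈⇒↭∷ (≡.setoid ℕ) (∈-applyDownFrom⁺ progression k<p)
        R : List ℕ
        R = Product.proj₁ extracted
        N≡ : N ≡ (progression p * product R) * progression k
        N≡ = begin
          N                                                      ≡⟨ !!!≡product p ⟩
          progression p * product (applyDownFrom progression p)  ≡⟨ cong (progression p *_)
                                                                     (Permutationₚ.foldr-commMonoid (≡.setoid ℕ) ℕ.*-1-isCommutativeMonoid (Product.proj₂ extracted)) ⟩
          progression p * (progression k * product R)            ≡⟨ lemma (progression p) (progression k) (product R) ⟩
          (progression p * product R) * progression k            ∎
          where
          open ≡-Reasoning
          lemma : ∀ a b c → a * (b * c) ≡ (a * c) * b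
          lemma = solveℕ-∀
        R-reduced : IsReducedResidueSystem (map +_ R)
        R-reduced = complete⇒reduced
          (complete-resp-↭ (Permutationₚ.map⁺ (≡.setoid ℕ) ≈-setoid (≈-reflexive ∘ cong (λ n → + n)) (Product.proj₂ extracted)) progression-complete)
          progression[k]≈0
        quotient≈-1 : + (N / progression k) ≈ -1ℤ
        quotient≈-1 = begin
          + (N / progression k)                        ≡⟨ cong +_ (trans (/-congˡ N≡) (m*n/n≡m _ (progression k))) ⟩
          + (progression p * product R)                ≡⟨ ℤ.pos-* (progression p) (product R) ⟩
          + progression p ℤ.* + product R              ≡⟨ cong (ℤ._*_ (+ progression p)) (pos-product R) ⟩
          + progression p ℤ.* foldr ℤ._*_ 1ℤ (map +_ R) ≈⟨ *-cong progression[p]≈1 (reduced⇒∏≈-1 (ℕ.<⇒≤ 3<p) R-reduced) ⟩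
          -1ℤ                                          ∎
          where open SetoidReasoning ≈-setoid

      p∣δℕ+1 : ∀ {r₀} → k ≡ suc r₀ → r₀ ∈ summationRange p → p ∣ δℕ p + 1
      p∣δℕ+1 {r₀} k≡1+r₀ r₀∈ = subst (p ∣_) (sym δℕ+1≡) (∣m∣n⇒∣m+n p∣t[r₀]+1 (∣m∣n⇒∣m+n p∣N p∣rest))
        where
        open Permutation (≡.setoid ℕ) using () renaming (_↭_ to _↭ₙ_; ↭-sym to ↭ₙ-sym)
        t : ℕ → ℕ
        t r = N / (4 + 3 * r)
        t≡ : ∀ r → N / progression (suc r) ≡ t r
        t≡ r = /-congʳ {m = N} (progression-suc r)
        extracted : ∃[ rs ] summationRange p ↭ₙ r₀ ∷ rs
        extracted = ∈⇒↭∷ (≡.setoid ℕ) r₀∈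
        rs : List ℕ
        rs = Product.proj₁ extracted
        range↭ : summationRange p ↭ₙ r₀ ∷ rs
        range↭ = Product.proj₂ extracted
        sum≡ : sum (map t (summationRange p)) ≡ t r₀ + sum (map t rs)
        sum≡ = Permutationₚ.foldr-commMonoid (≡.setoid ℕ) ℕ.+-0-isCommutativeMonoid
                 (Permutationₚ.map⁺ (≡.setoid ℕ) (≡.setoid ℕ) (cong t) range↭)
        δℕ+1≡ : δℕ p + 1 ≡ (t r₀ + 1) + (N + sum (map t rs))
        δℕ+1≡ = trans (cong (λ s → N + s + 1) sum≡) (lemma N (t r₀) (sum (map t rs)))
          where
          lemma : ∀ a b c → a + (b + c) + 1 ≡ (b + 1) + (a + c)
          lemma = solveℕ-∀
        p∣t[r₀]+1 : p ∣ t r₀ + 1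
        p∣t[r₀]+1 = subst (λ q → p ∣ q + 1) (t≡ r₀) (subst (λ j → p ∣ N / progression j + 1) k≡1+r₀ p∣N/progression[k]+1)
        unique : Unique (r₀ ∷ rs)
        unique = Permutationₚ.Unique-resp-↭ (≡.setoid ℕ) range↭ (UniqueProp.map⁺ ℕ.suc-injective (UniqueProp.upTo⁺ (p ∸ 1)))
        p∣rest : p ∣ sum (map t rs)
        p∣rest = ∣-sum t λ {r} r∈rs → subst (p ∣_) (t≡ r)
          (p∣N/progression (∈-summationRange⁻ (Permutationₚ.∈-resp-↭ (≡.setoid ℕ) (↭ₙ-sym range↭) (there r∈rs)))
            (λ 1+r≡k → Unique[x∷xs]∧z∈xs⇒z≉x (≡.setoid ℕ) unique r∈rs (ℕ.suc-injective (trans 1+r≡k k≡1+r₀))))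


open import Defs using (δ)
open import Data.Nat.Coprimality using (Coprime; 1-coprimeTo)
open import Data.Integer using (+_; _+_)
open import Data.Integer.Divisibility using (_∣_)
open import Data.Rational using (↥_; ↧_; ↧ₙ_)
open Integrality using (δ≡fromℕ-δℕ)
open DeltaModP using (∃-progression≈0; zero-index-in-range; p∣δℕ+1)

proposition4 : (p : ℕ) → Prime p → 3 < p →
    Coprime (↧ₙ δ p) p × (+ p) ∣ ((↥ δ p) + (↧ δ p))
proposition4 p p-prime 3<p rewrite δ≡fromℕ-δℕ p =
  let k , k<p , progression[k]≈0 = ∃-progression≈0 p-prime 3<p
      r₀ , k≡1+r₀ , r₀∈ = zero-index-in-range p-prime 3<p k<p progression[k]≈0
  in 1-coprimeTo p , p∣δℕ+1 p-prime 3<p k<p progression[k]≈0 k≡1+r₀ r₀∈
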